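{- Let $G$ be a permutation graph and fix a permutation diagram for $G$. Then \[\gamma^i(G) = \max\{\, k \;:\; k \in \gamma_x(z),\ x \in V(G),\ z \in N[x] \,\}.\]
   Context: A permutation diagram consists of two horizontal lines in the plane and $n$ line segments, each connecting a point on the top line with a point on the bottom line; $G$ is a permutation graph if it is the intersection graph of the segments of some permutation diagram (vertices = segments, adjacent iff the segments cross). An independent set $M$ of $G$ corresponds to pairwise non-crossing segments, which are linearly ordered left to right; $M$ ends in $x$ if the segment of $x$ is the right-most segment of $M$. For a set $B$ of vertices, $\gamma(B)$ is the minimum cardinality of a set $A$ of vertices with $B \subseteq \bigcup_{a\in A} N[a]$. For $x \in V$ and $k\in\mathbb{N}$, $\Gamma(x;k)$ is the collection of minimum dominating sets (sets $A$ of size $\gamma(M)$ dominating $M$) of independent sets $M$ that end in $x$ with $\gamma(M)=k$. For a condition on neighbors of $x$, $z$ is a right-most neighbor of $x$ satisfying it if $z \in N[x]$ (allowing $z=x$) satisfies it and the endpoint of $z$ on the top line or on the bottom line is right-most among all vertices of $N[x]$ satisfying it. For $x\in V$ and $z \in N[x]$, $\gamma_x(z)$ is the set of $k$ such that $z$ is a right-most neighbor of $x$ among those lying in some $\Gamma \in \Gamma(x;k)$, and $z \in \Gamma$ for some $\Gamma \in \Gamma(x;k)$. The independence-domination number is $\gamma^i(G)=\max\{\gamma(A): A \text{ independent in } G\}$. -}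

module Defs where

open import Data.Nat using (ℕ; _<_; _≤_)
open import Data.Fin using (Fin)
open import Data.Fin.Subset using (Subset; _∈_; ∣_∣)
open import Data.Product using (Σ; ∃; ∃-syntax; _×_)
open import Data.Sum using (_⊎_)
open import Relation.Nullary using (¬_)
open import Relation.Binary.PropositionalEquality using (_≡_)
open import Function.Definitions using (Injective)

-- A permutation diagram with n segments: segment i joins position
-- top i on the top line with position bottom i on the bottom line.
-- Endpoints on each line are pairwise distinct.
record Diagram (n : ℕ) : Set where
  field
    top    : Fin n → ℕ
    bottom : Fin n → ℕ
    top-inj    : Injective _≡_ _≡_ top
    bottom-inj : Injective _≡_ _≡_ bottom
open Diagram public

module _ {n : ℕ} (D : Diagram n) where

  -- segments i and j cross  (= adjacency in the permutation graph G)
  Cross : Fin n → Fin n → Set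
  Cross i j = (top D i < top D j × bottom D j < bottom D i)
            ⊎ (top D j < top D i × bottom D i < bottom D j)

  InN : Fin n → Fin n → Set
  InN x z = z ≡ x ⊎ Cross x z

  Dominates : Subset n → Subset n → Set
  Dominates A B = ∀ b → b ∈ B → ∃[ a ] (a ∈ A × InN a b)

  IsGamma : Subset n → ℕ → Set
  IsGamma B k = (∃[ A ] (Dominates A B × ∣ A ∣ ≡ k))
              × (∀ A → Dominates A B → k ≤ ∣ A ∣)

  Independent : Subset n → Set
  Independent M = ∀ x y → x ∈ M → y ∈ M → ¬ Cross x y

  EndsIn : Subset n → Fin n → Set
  EndsIn M x = x ∈ M × (∀ y → y ∈ M → top D y ≤ top D x)

  InΓ : Fin n → ℕ → Subset n → Set
  InΓ x k A = ∃[ M ] (Independent M × EndsIn M x × IsGamma M k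
                      × Dominates A M × ∣ A ∣ ≡ k)

  RightMostNbr : Fin n → (Fin n → Set) → Fin n → Set
  RightMostNbr x P z = InN x z × P z ×
    ((∀ w → InN x w → P w → top D w ≤ top D z)
     ⊎ (∀ w → InN x w → P w → bottom D w ≤ bottom D z))

  InGammaX : Fin n → Fin n → ℕ → Set
  InGammaX x z k =
    RightMostNbr x (λ w → ∃[ A ] (InΓ x k A × w ∈ A)) z
    × ∃[ A ] (InΓ x k A × z ∈ A)

  IsIndepDomNumber : ℕ → Set
  IsIndepDomNumber g = (∃[ A ] (Independent A × IsGamma A g))
    × (∀ A k → Independent A → IsGamma A k → k ≤ g)

IsMaximum : (ℕ → Set) → ℕ → Set
IsMaximum S g = S g × (∀ k → S k → k ≤ g)

-- For every independent set M with γ(M) = k ≥ 1, let x be its right-most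
-- segment and A a minimum dominating set of M. Then A ∈ Γ(x;k), and the
-- vertex of A dominating x lies in N[x] ∩ A, so among the neighbours of x
-- lying in some member of Γ(x;k) one with right-most top endpoint exists;
-- it witnesses k ∈ γ_x(z). Conversely every k ∈ γ_x(z) is γ(M) for an
-- independent M. Hence both maxima range over the same values, and the
-- maximum exists because γ ≤ n and everything is decidable on a finite diagram.
module Submission where

open import Defs
open import Data.Nat using (ℕ; zero; suc; _≤_; z≤n; s≤s; _<?_; _≤?_)
open import Data.Nat.Properties using (≤-refl; ≤-trans; ≤-total; <-irrefl)
import Data.Nat.Properties as ℕ
open import Data.Fin using (Fin; zero; suc; toℕ; fromℕ<)
open import Data.Fin.Properties using (any?; all?; toℕ-fromℕ<) renaming (_≟_ to _≟ᶠ_)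
open import Data.Fin.Subset using (Subset; _∈_; ∣_∣; ⁅_⁆; ⊤; ⊥; Nonempty)
open import Data.Fin.Subset.Properties
  using (_∈?_; anySubset?; ∣⊤∣≡n; ∣⊥∣≡0; ∣⁅x⁆∣≡1; x∈⁅x⁆; x∈⁅y⁆⇒x≡y; x∈p⇒∣p-x∣<∣p∣; ∈⊤)
open import Data.Product using (Σ; ∃-syntax; _×_; _,_)
open import Data.Sum using (inj₁; inj₂)
open import Function using (_∘_)
open import Level using (Level)
open import Relation.Nullary using (¬_; Dec; yes; no; ¬?; contradiction)
open import Relation.Nullary.Decidable using (_×-dec_; _⊎-dec_; _→-dec_; decidable-stable)
open import Relation.Unary using (Pred; Decidable; Satisfiable)
open import Relation.Binary.PropositionalEquality using (_≡_; refl; sym; subst)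

private variable p : Level

argmax : ∀ {n} {P : Pred (Fin n) p} → Decidable P → (f : Fin n → ℕ) → Satisfiable P →
         ∃[ z ] (P z × ∀ w → P w → f w ≤ f z)
argmax {n = zero} P? f (() , _)
argmax {n = suc n} P? f w with any? (P? ∘ suc)
argmax {n = suc n} P? f (zero , p₀) | no ¬tail =
  zero , p₀ , λ { zero _ → ≤-refl ; (suc v) pv → contradiction (v , pv) ¬tail }
argmax {n = suc n} P? f (suc v , pv) | no ¬tail = contradiction (v , pv) ¬tail
... | yes tail with argmax (P? ∘ suc) (f ∘ suc) tail
...   | z , pz , maxz with P? zero
...     | no ¬p₀ = suc z , pz , λ { zero p₀ → contradiction p₀ ¬p₀ ; (suc v) pv → maxz v pv }
...     | yes p₀ with ≤-total (f (suc z)) (f zero)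
...       | inj₁ le = zero , p₀ , λ { zero _ → ≤-refl ; (suc v) pv → ≤-trans (maxz v pv) le }
...       | inj₂ ge = suc z , pz , λ { zero _ → ge ; (suc v) pv → maxz v pv }

boundedMaximum : {Q : ℕ → Set} → Decidable Q → (B : ℕ) → (∀ k → Q k → k ≤ B) →
                 Satisfiable Q → Σ ℕ (IsMaximum Q)
boundedMaximum {Q} Q? B bound (_ , qk) =
  let i , qi , maximal = argmax (Q? ∘ toℕ) toℕ (_ , embed qk)
  in toℕ i , qi , λ _ qj → subst (_≤ toℕ i) (toℕ-asFin qj) (maximal _ (embed qj))
  where
  asFin : ∀ {k} → Q k → Fin (suc B)
  asFin {k} qk = fromℕ< (s≤s (bound k qk))
  toℕ-asFin : ∀ {k} (qk : Q k) → toℕ (asFin qk) ≡ k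
  toℕ-asFin {k} qk = toℕ-fromℕ< (s≤s (bound k qk))
  embed : ∀ {k} (qk : Q k) → Q (toℕ (asFin qk))
  embed qk = subst Q (sym (toℕ-asFin qk)) qk

allSubset? : ∀ {n} {P : Pred (Subset n) p} → Decidable P → Dec (∀ A → P A)
allSubset? P? with anySubset? (¬? ∘ P?)
... | yes (A , ¬pA) = no (λ all → ¬pA (all A))
... | no ¬any = yes (λ A → decidable-stable (P? A) (λ ¬pA → ¬any (A , ¬pA)))

module _ {n : ℕ} (D : Diagram n) where

  cross? : ∀ i j → Dec (Cross D i j)
  cross? i j = ((top D i <? top D j) ×-dec (bottom D j <? bottom D i))
         ⊎-dec ((top D j <? top D i) ×-dec (bottom D i <? bottom D j))

  inN? : ∀ x z → Dec (InN D x z)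
  inN? x z = (z ≟ᶠ x) ⊎-dec cross? x z

  dominates? : ∀ A B → Dec (Dominates D A B)
  dominates? A B = all? (λ b → (b ∈? B) →-dec any? (λ a → (a ∈? A) ×-dec inN? a b))

  isGamma? : ∀ B k → Dec (IsGamma D B k)
  isGamma? B k = anySubset? (λ A → dominates? A B ×-dec (∣ A ∣ ℕ.≟ k))
           ×-dec allSubset? (λ A → dominates? A B →-dec (k ≤? ∣ A ∣))

  independent? : ∀ M → Dec (Independent D M)
  independent? M = all? λ x → all? λ y → (x ∈? M) →-dec ((y ∈? M) →-dec ¬? (cross? x y))

  endsIn? : ∀ M x → Dec (EndsIn D M x)
  endsIn? M x = (x ∈? M) ×-dec all? (λ y → (y ∈? M) →-dec (top D y ≤? top D x))

  inΓ? : ∀ x k A → Dec (InΓ D x k A)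
  inΓ? x k A = anySubset? (λ M → independent? M ×-dec endsIn? M x ×-dec isGamma? M k
                                   ×-dec dominates? A M ×-dec (∣ A ∣ ℕ.≟ k))

  independentGamma? : ∀ k → Dec (∃[ A ] (Independent D A × IsGamma D A k))
  independentGamma? k = anySubset? (λ A → independent? A ×-dec isGamma? A k)

  inSomeΓ? : ∀ x k w → Dec (∃[ A ] (InΓ D x k A × w ∈ A))
  inSomeΓ? x k w = anySubset? (λ A → inΓ? x k A ×-dec (w ∈? A))

  Cross-irrefl : ∀ {a} → ¬ Cross D a a
  Cross-irrefl (inj₁ (lt , _)) = <-irrefl refl lt
  Cross-irrefl (inj₂ (lt , _)) = <-irrefl refl lt

  InN-sym : ∀ {a b} → InN D a b → InN D b a
  InN-sym (inj₁ refl)             = inj₁ refl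
  InN-sym (inj₂ (inj₁ crossing)) = inj₂ (inj₂ crossing)
  InN-sym (inj₂ (inj₂ crossing)) = inj₂ (inj₁ crossing)

  γ≤n : ∀ {B k} → IsGamma D B k → k ≤ n
  γ≤n (_ , minimal) = subst (_ ≤_) (∣⊤∣≡n n) (minimal ⊤ (λ b _ → b , ∈⊤ , inj₁ refl))

  γ-positive⇒Nonempty : ∀ {B k} → IsGamma D B k → 1 ≤ k → Nonempty B
  γ-positive⇒Nonempty {B} {k} (_ , minimal) 1≤k with any? (_∈? B)
  ... | yes nonempty = nonempty
  ... | no empty = contradiction (≤-trans 1≤k k≤0) λ ()
    where
    k≤0 : k ≤ 0
    k≤0 = subst (_ ≤_) (∣⊥∣≡0 n) (minimal ⊥ (λ b b∈B → contradiction (b , b∈B) empty))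

  ⁅x⁆-independent : ∀ x → Independent D ⁅ x ⁆
  ⁅x⁆-independent x y z y∈ z∈ with x∈⁅y⁆⇒x≡y x y∈ | x∈⁅y⁆⇒x≡y x z∈
  ... | refl | refl = Cross-irrefl

  γ⁅x⁆≡1 : ∀ x → IsGamma D ⁅ x ⁆ 1
  γ⁅x⁆≡1 x = (⁅ x ⁆ , (λ b b∈ → b , b∈ , inj₁ refl) , ∣⁅x⁆∣≡1 x) , atLeastOne
    where
    atLeastOne : ∀ A → Dominates D A ⁅ x ⁆ → 1 ≤ ∣ A ∣
    atLeastOne A dom with dom x (x∈⁅x⁆ x)
    ... | a , a∈A , _ = ≤-trans (s≤s z≤n) (x∈p⇒∣p-x∣<∣p∣ a∈A)

  γⁱ-exists : 1 ≤ n → Σ ℕ (IsIndepDomNumber D)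
  γⁱ-exists (s≤s _) =
    let g , witness , maximal = boundedMaximum independentGamma? n (λ _ (_ , _ , γ) → γ≤n γ)
                                                (1 , ⁅ zero ⁆ , ⁅x⁆-independent zero , γ⁅x⁆≡1 zero)
    in g , witness , λ A k iA γ → maximal k (A , iA , γ)

  rightmost : ∀ {M} → Nonempty M → ∃[ x ] EndsIn D M x
  rightmost {M} = argmax (_∈? M) (top D)

  rightMostNbr-exists : ∀ {x} {P : Fin n → Set} → Decidable P →
                        Satisfiable (λ w → InN D x w × P w) → ∃[ z ] RightMostNbr D x P z
  rightMostNbr-exists {x} P? candidate with argmax (λ w → inN? x w ×-dec P? w) (top D) candidate
  ... | z , (xz , pz) , maximal = z , xz , pz , inj₁ (λ w xw pw → maximal w (xw , pw))

  γ∈γₓ : ∀ {M k} → Independent D M → IsGamma D M k → 1 ≤ k →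
         ∃[ x ] ∃[ z ] (InN D x z × InGammaX D x z k)
  γ∈γₓ {M} {k} iM γM@((A , dominatesM , ∣A∣≡k) , _) 1≤k =
    let x , x∈M , rightmostX = rightmost (γ-positive⇒Nonempty γM 1≤k)
        a , a∈A , ax = dominatesM x x∈M
        A∈Γ : InΓ D x k A
        A∈Γ = M , iM , (x∈M , rightmostX) , γM , dominatesM , ∣A∣≡k
        z , xz , z∈Γ , rightmostZ = rightMostNbr-exists (inSomeΓ? x k) (a , InN-sym ax , A , A∈Γ , a∈A)
    in x , z , xz , (xz , z∈Γ , rightmostZ) , z∈Γ

  γₓ⇒γ : ∀ {x z k} → InGammaX D x z k → ∃[ M ] (Independent D M × IsGamma D M k)
  γₓ⇒γ (_ , _ , (M , iM , _ , γM , _) , _) = M , iM , γM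

mainTheorem4 : (n : ℕ) → 1 ≤ n → (D : Diagram n) →
    Σ ℕ λ g → IsIndepDomNumber D g
    × IsMaximum (λ k → ∃[ x ] ∃[ z ] (InN D x z × InGammaX D x z k)) g
mainTheorem4 (suc n) 1≤n D with γⁱ-exists D 1≤n
... | g , γⁱ@((M , iM , γM) , maximal) =
  g , γⁱ , γ∈γₓ D iM γM 1≤g , λ k (_ , _ , _ , k∈γₓ) →
    let M′ , iM′ , γM′ = γₓ⇒γ D k∈γₓ in maximal M′ k iM′ γM′
  where
  1≤g : 1 ≤ g
  1≤g = maximal ⁅ zero ⁆ 1 (⁅x⁆-independent D zero) (γ⁅x⁆≡1 D zero)
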